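{- Let $k$ be an even positive integer. For every integer $n>0$, let $b=\lfloor \log_2 n\rfloor$ and $c=n+1-2^{b}$. Then $$a_k(n)=\frac{(2^b+c)^k+(2^b-c)^k-2c^k}{2^{b+1}}+a_k(c-1).$$
   Context: A P-position of the game of Nim with $k$ piles is a $k$-tuple $(p_1,\dots,p_k)$ of non-negative integers whose nim-sum $p_1\oplus\cdots\oplus p_k$ is $0$, where $\oplus$ denotes bitwise XOR. $a_k(m)$ denotes the number of P-positions with $k$ piles such that every pile has at most $m$ counters, for $m\ge0$ (so $a_k(0)=1$). -}

module Defs where

open import Data.Nat using (ℕ; zero; suc; _+_; _*_; _%_; _/_; _≡ᵇ_)
open import Data.Nat.Properties using (_≟_)
open import Data.Bool using (Bool; true; false; if_then_else_)
open import Data.List using (List; []; _∷_; map; concatMap; length; filter; upTo)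
open import Data.Vec using (Vec; []; _∷_; foldr)
open import Relation.Binary.PropositionalEquality using (_≡_)

-- Bitwise XOR on ℕ, computed bit by bit with a fuel parameter.
-- With fuel ≥ the number of binary digits of both arguments the
-- result is the genuine XOR; fuel m + n always suffices.
xor-fuel : ℕ → ℕ → ℕ → ℕ
xor-fuel zero    m n = 0
xor-fuel (suc f) m n =
  ((m + n) % 2) + 2 * xor-fuel f (m / 2) (n / 2)

_⊕_ : ℕ → ℕ → ℕ
m ⊕ n = xor-fuel (m + n) m n

infixl 6 _⊕_

nimSum : ∀ {k} → Vec ℕ k → ℕ
nimSum = foldr _ _⊕_ 0

tuples : (k m : ℕ) → List (Vec ℕ k)
tuples zero    m = [] ∷ []
tuples (suc k) m = concatMap (λ x → map (x ∷_) (tuples k m)) (upTo (suc m))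

-- a k m = a_k(m): number of P-positions of k-pile Nim (nim-sum 0)
-- with every pile having at most m counters.
a : (k m : ℕ) → ℕ
a k m = length (filter (λ p → nimSum p ≟ 0) (tuples k m))

-- Write n = 2^b + m with m < 2^b and c = m + 1, and call a pile low if it is
-- below 2^b and high otherwise.  Whatever the other piles are, exactly one value
-- of a low pile fixes the lower b bits of the nim-sum, so the tuples containing a
-- low pile are counted by a recursion in k whose coefficients involve only 2^b
-- and c.  The top bit of the nim-sum of k high piles is the parity of k, so for
-- even k the all-high P-positions are those of piles 2^b + y with y ≤ m, counted
-- by a_k(m) = a_k(c - 1).  Solving the recursion gives the closed form.
module Submission where

open import Defs
open import Data.Nat
  using (ℕ; zero; suc; _+_; _*_; _∸_; _^_; _≤_; _<_; _%_; _/_; z≤n; s≤s; _≟_; ⌊_/2⌋; >-nonZero)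
open import Data.Nat.Logarithm using (⌊log₂_⌋; ⌊log₂⌋-mono-≤; ⌊log₂⌊n/2⌋⌋≡⌊log₂n⌋∸1)
open import Data.Integer using (ℤ; +_; _-_; 1ℤ; -1ℤ)
open import Data.Nat.Divisibility using (_∣_; divides)
open import Data.Product using (_×_; _,_; proj₁; proj₂)
open import Relation.Binary.PropositionalEquality

open import Data.Bool using (Bool; true; false; _xor_; not)
open import Data.Bool.Properties using (xor-comm; xor-assoc; xor-same; not-involutive)
import Data.Integer as ℤ using (_+_; _*_; _^_; -_)
import Data.Integer.Properties as ℤₚ
import Data.Integer.Tactic.RingSolver as ℤ-Solver
open import Data.List as List using (List; []; _∷_; concatMap; map; filter; length; upTo; applyUpTo)
open import Data.List.Properties using (filter-++; length-++; filter-≐)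
open import Data.Nat.DivMod using (%-distribˡ-+; [m+kn]%n≡m%n; +-distrib-/-∣ʳ; m*n/n≡m; m/n*n≤m; m/n≤m)
open import Data.Nat.Induction using (<-rec)
open import Data.Nat.ListAction using (sum)
open import Data.Nat.Properties
open import Data.Nat.Tactic.RingSolver using (solve-∀)
import Data.Vec as Vec
open import Level using (0ℓ)
open import Relation.Nullary using (does)
open import Relation.Unary using (Pred; Decidable)

-- Binary digits

bit : Bool → ℕ
bit false = 0
bit true  = 1

double : ℕ → ℕ
double zero    = zero
double (suc n) = suc (suc (double n))

infixr 7 _◂_

_◂_ : Bool → ℕ → ℕ
β ◂ q = bit β + double q

double≡*2 : ∀ n → double n ≡ n * 2
double≡*2 zero    = refl
double≡*2 (suc n) = cong (λ m → suc (suc m)) (double≡*2 n)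

◂-suc : ∀ β q → β ◂ suc q ≡ suc (suc (β ◂ q))
◂-suc false q = refl
◂-suc true  q = refl

data Parity : ℕ → Set where
  parity : (β : Bool) (q : ℕ) → Parity (β ◂ q)

parity-view : ∀ x → Parity x
parity-view zero          = parity false 0
parity-view (suc zero)    = parity true 0
parity-view (suc (suc x)) with parity-view x
... | parity false q = parity false (suc q)
... | parity true  q = parity true (suc q)

[β◂q]%2≡bitβ : ∀ β q → (β ◂ q) % 2 ≡ bit β
[β◂q]%2≡bitβ β q rewrite double≡*2 q = trans ([m+kn]%n≡m%n (bit β) q 2) (bit%2 β)
  where
  bit%2 : ∀ β → bit β % 2 ≡ bit β
  bit%2 false = refl
  bit%2 true  = refl

[β◂q]/2≡q : ∀ β q → (β ◂ q) / 2 ≡ q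
[β◂q]/2≡q β q rewrite double≡*2 q =
  trans (+-distrib-/-∣ʳ (bit β) (divides q refl)) (cong₂ _+_ (bit/2 β) (m*n/n≡m q 2))
  where
  bit/2 : ∀ β → bit β / 2 ≡ 0
  bit/2 false = refl
  bit/2 true  = refl

⌊β◂q/2⌋≡q : ∀ β q → ⌊ β ◂ q /2⌋ ≡ q
⌊β◂q/2⌋≡q false zero    = refl
⌊β◂q/2⌋≡q true  zero    = refl
⌊β◂q/2⌋≡q β     (suc q) rewrite ◂-suc β q = cong suc (⌊β◂q/2⌋≡q β q)

double-mono-≤ : ∀ {x y} → x ≤ y → double x ≤ double y
double-mono-≤ z≤n       = z≤n
double-mono-≤ (s≤s x≤y) = s≤s (s≤s (double-mono-≤ x≤y))

◂<double⇒< : ∀ β q N → β ◂ q < double N → q < N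
◂<double⇒< β     q       zero    ()
◂<double⇒< β     zero    (suc N) _             = s≤s z≤n
◂<double⇒< false (suc q) (suc N) (s≤s (s≤s h)) = s≤s (◂<double⇒< false q N h)
◂<double⇒< true  (suc q) (suc N) (s≤s (s≤s h)) = s≤s (◂<double⇒< true q N h)

<⇒◂<double : ∀ β q N → q < N → β ◂ q < double N
<⇒◂<double false zero    (suc N) _         = s≤s z≤n
<⇒◂<double true  zero    (suc N) _         = s≤s (s≤s z≤n)
<⇒◂<double false (suc q) (suc N) (s≤s q<N) = s≤s (s≤s (<⇒◂<double false q N q<N))
<⇒◂<double true  (suc q) (suc N) (s≤s q<N) = s≤s (s≤s (<⇒◂<double true q N q<N))

2^suc≡double : ∀ b → 2 ^ suc b ≡ double (2 ^ b)
2^suc≡double b = sym (trans (double≡*2 (2 ^ b)) (*-comm (2 ^ b) 2))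

n<2^n : ∀ n → n < 2 ^ n
n<2^n zero    = s≤s z≤n
n<2^n (suc n) = begin-strict
  suc n         <⟨ s≤s (n<2^n n) ⟩
  1 + 2 ^ n     ≤⟨ +-monoˡ-≤ (2 ^ n) (m^n>0 2 n) ⟩
  2 ^ n + 2 ^ n ≡⟨ cong (_+_ (2 ^ n)) (+-identityʳ (2 ^ n)) ⟨
  2 ^ suc n     ∎
  where open ≤-Reasoning

log₂-bounds : ∀ n → 0 < n → 2 ^ ⌊log₂ n ⌋ ≤ n × n < 2 ^ suc ⌊log₂ n ⌋
log₂-bounds = <-rec _ bounds
  where
  bounds : ∀ n → (∀ {k} → k < n → 0 < k → 2 ^ ⌊log₂ k ⌋ ≤ k × k < 2 ^ suc ⌊log₂ k ⌋) →
           0 < n → 2 ^ ⌊log₂ n ⌋ ≤ n × n < 2 ^ suc ⌊log₂ n ⌋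
  bounds n rec 0<n with parity-view n
  bounds .0 rec () | parity false zero
  ... | parity true zero  = s≤s z≤n , s≤s (s≤s z≤n)
  ... | parity β (suc q) = subst (λ L → 2 ^ L ≤ x × x < 2 ^ suc L) (sym ⌊log₂x⌋≡1+L) (lower , upper)
    where
    x = β ◂ suc q
    L = ⌊log₂ (suc q) ⌋
    double≤x : double (suc q) ≤ x
    double≤x = m≤n+m (double (suc q)) (bit β)
    IH : 2 ^ L ≤ suc q × suc q < 2 ^ suc L
    IH = rec (≤-trans (s≤s (s≤s (subst (q ≤_) (sym (double≡*2 q)) (m≤m*n q 2)))) double≤x) (s≤s z≤n)
    1≤⌊log₂x⌋ : 1 ≤ ⌊log₂ x ⌋
    1≤⌊log₂x⌋ = ⌊log₂⌋-mono-≤ (≤-trans (s≤s (s≤s z≤n)) double≤x)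
    ⌊log₂x⌋≡1+L : ⌊log₂ x ⌋ ≡ suc L
    ⌊log₂x⌋≡1+L = begin
      ⌊log₂ x ⌋            ≡⟨ suc-pred ⌊log₂ x ⌋ {{>-nonZero 1≤⌊log₂x⌋}} ⟨
      suc (⌊log₂ x ⌋ ∸ 1)  ≡⟨ cong suc (⌊log₂⌊n/2⌋⌋≡⌊log₂n⌋∸1 x) ⟨
      suc ⌊log₂ ⌊ x /2⌋ ⌋  ≡⟨ cong (λ y → suc ⌊log₂ y ⌋) (⌊β◂q/2⌋≡q β (suc q)) ⟩
      suc L                ∎
      where open ≡-Reasoning
    lower : 2 ^ suc L ≤ x
    lower = ≤-trans (≤-reflexive (2^suc≡double L)) (≤-trans (double-mono-≤ (proj₁ IH)) double≤x)
    upper : x < 2 ^ suc (suc L)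
    upper = subst (x <_) (sym (2^suc≡double (suc L))) (<⇒◂<double β (suc q) _ (proj₂ IH))

-- Nim-sum

xor-fuel-0-0 : ∀ f → xor-fuel f 0 0 ≡ 0
xor-fuel-0-0 zero    = refl
xor-fuel-0-0 (suc f) = cong (2 *_) (xor-fuel-0-0 f)

halves-≤ : ∀ m n f → m + n ≤ suc f → m / 2 + n / 2 ≤ f
halves-≤ m n f m+n≤1+f = *2≤1+f⇒≤f (m / 2 + n / 2) (begin
  (m / 2 + n / 2) * 2   ≡⟨ *-distribʳ-+ 2 (m / 2) (n / 2) ⟩
  m / 2 * 2 + n / 2 * 2 ≤⟨ +-mono-≤ (m/n*n≤m m 2) (m/n*n≤m n 2) ⟩
  m + n                 ≤⟨ m+n≤1+f ⟩
  suc f                 ∎)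
  where
  open ≤-Reasoning
  *2≤1+f⇒≤f : ∀ s → s * 2 ≤ suc f → s ≤ f
  *2≤1+f⇒≤f zero    _             = z≤n
  *2≤1+f⇒≤f (suc s) (s≤s 1+2s≤f) = ≤-trans (s≤s (m≤m*n s 2)) 1+2s≤f

xor-fuel-irrelevant : ∀ f g m n → m + n ≤ f → m + n ≤ g → xor-fuel f m n ≡ xor-fuel g m n
xor-fuel-irrelevant zero    g       zero zero _ _ = sym (xor-fuel-0-0 g)
xor-fuel-irrelevant (suc f) zero    zero zero _ _ = xor-fuel-0-0 (suc f)
xor-fuel-irrelevant (suc f) (suc g) m    n    m+n≤f m+n≤g =
  cong (λ r → (m + n) % 2 + 2 * r)
       (xor-fuel-irrelevant f g (m / 2) (n / 2) (halves-≤ m n f m+n≤f) (halves-≤ m n g m+n≤g))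

⊕-unfold : ∀ m n → m ⊕ n ≡ (m + n) % 2 + 2 * (m / 2 ⊕ n / 2)
⊕-unfold m n =
  trans (xor-fuel-irrelevant (m + n) (suc (m + n)) m n ≤-refl (n≤1+n _))
        (cong (λ r → (m + n) % 2 + 2 * r)
              (xor-fuel-irrelevant (m + n) (m / 2 + n / 2) (m / 2) (n / 2)
                 (+-mono-≤ (m/n≤m m 2) (m/n≤m n 2)) ≤-refl))

⊕-◂ : ∀ β β' q q' → (β ◂ q) ⊕ (β' ◂ q') ≡ (β xor β') ◂ (q ⊕ q')
⊕-◂ β β' q q' = begin
  x ⊕ x'                               ≡⟨ ⊕-unfold x x' ⟩
  (x + x') % 2 + 2 * (x / 2 ⊕ x' / 2)  ≡⟨ cong₂ (λ r s → r + 2 * s) low-bit high-bits ⟩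
  bit (β xor β') + 2 * (q ⊕ q')        ≡⟨ cong (_+_ (bit (β xor β'))) 2*[q⊕q']≡double ⟩
  (β xor β') ◂ (q ⊕ q')                ∎
  where
  open ≡-Reasoning
  x  = β ◂ q
  x' = β' ◂ q'
  [bitβ+bitβ']%2 : ∀ β β' → (bit β + bit β') % 2 ≡ bit (β xor β')
  [bitβ+bitβ']%2 false false = refl
  [bitβ+bitβ']%2 false true  = refl
  [bitβ+bitβ']%2 true  false = refl
  [bitβ+bitβ']%2 true  true  = refl
  low-bit : (x + x') % 2 ≡ bit (β xor β')
  low-bit = trans (%-distribˡ-+ x x' 2)
                  (trans (cong₂ (λ r s → (r + s) % 2) ([β◂q]%2≡bitβ β q) ([β◂q]%2≡bitβ β' q'))
                         ([bitβ+bitβ']%2 β β'))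
  high-bits : x / 2 ⊕ x' / 2 ≡ q ⊕ q'
  high-bits = cong₂ _⊕_ ([β◂q]/2≡q β q) ([β◂q]/2≡q β' q')
  2*[q⊕q']≡double : 2 * (q ⊕ q') ≡ double (q ⊕ q')
  2*[q⊕q']≡double = trans (*-comm 2 (q ⊕ q')) (sym (double≡*2 (q ⊕ q')))

-- Bits b x : x written with b binary digits, least significant first.
data Bits : ℕ → ℕ → Set where
  []  : Bits 0 0
  _∷_ : ∀ {b q} (β : Bool) → Bits b q → Bits (suc b) (β ◂ q)

Bits⇒< : ∀ {b x} → Bits b x → x < 2 ^ b
Bits⇒< []               = s≤s z≤n
Bits⇒< (_∷_ {b} β bits) = subst (_ <_) (sym (2^suc≡double b)) (<⇒◂<double β _ _ (Bits⇒< bits))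

<⇒Bits : ∀ b {x} → x < 2 ^ b → Bits b x
<⇒Bits zero    {zero}  _ = []
<⇒Bits zero    {suc x} (s≤s ())
<⇒Bits (suc b) {x} x<2^1+b with parity-view x
... | parity β q = β ∷ <⇒Bits b (◂<double⇒< β q (2 ^ b) (subst (_ <_) (2^suc≡double b) x<2^1+b))

≤⇒Bits : ∀ {b x} → x ≤ b → Bits b x
≤⇒Bits {b} x≤b = <⇒Bits b (≤-<-trans x≤b (n<2^n b))

⊕-Bits : ∀ {b x y} → Bits b x → Bits b y → Bits b (x ⊕ y)
⊕-Bits []       []         = []
⊕-Bits (β ∷ xs) (β' ∷ ys) = subst (Bits _) (sym (⊕-◂ β β' _ _)) ((β xor β') ∷ ⊕-Bits xs ys)

⊕-< : ∀ b {x y} → x < 2 ^ b → y < 2 ^ b → x ⊕ y < 2 ^ b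
⊕-< b x<2^b y<2^b = Bits⇒< (⊕-Bits (<⇒Bits b x<2^b) (<⇒Bits b y<2^b))

Bits-⊕-identityˡ : ∀ {b x} → Bits b x → 0 ⊕ x ≡ x
Bits-⊕-identityˡ []       = refl
Bits-⊕-identityˡ (β ∷ xs) = trans (⊕-◂ false β 0 _) (cong (β ◂_) (Bits-⊕-identityˡ xs))

Bits-⊕-same : ∀ {b x} → Bits b x → x ⊕ x ≡ 0
Bits-⊕-same []       = refl
Bits-⊕-same (β ∷ xs) = trans (⊕-◂ β β _ _) (cong₂ _◂_ (xor-same β) (Bits-⊕-same xs))

Bits-⊕-comm : ∀ {b x y} → Bits b x → Bits b y → x ⊕ y ≡ y ⊕ x
Bits-⊕-comm []       []         = refl
Bits-⊕-comm (β ∷ xs) (β' ∷ ys) =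
  trans (⊕-◂ β β' _ _) (trans (cong₂ _◂_ (xor-comm β β') (Bits-⊕-comm xs ys)) (sym (⊕-◂ β' β _ _)))

Bits-⊕-assoc : ∀ {b x y z} → Bits b x → Bits b y → Bits b z → (x ⊕ y) ⊕ z ≡ x ⊕ (y ⊕ z)
Bits-⊕-assoc [] [] [] = refl
Bits-⊕-assoc (_∷_ {q = q} β xs) (_∷_ {q = q'} β' ys) (_∷_ {q = q''} β'' zs) = begin
  ((β ◂ q) ⊕ (β' ◂ q')) ⊕ (β'' ◂ q'')      ≡⟨ cong (_⊕ (β'' ◂ q'')) (⊕-◂ β β' q q') ⟩
  ((β xor β') ◂ (q ⊕ q')) ⊕ (β'' ◂ q'')    ≡⟨ ⊕-◂ (β xor β') β'' (q ⊕ q') q'' ⟩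
  ((β xor β') xor β'') ◂ ((q ⊕ q') ⊕ q'')  ≡⟨ cong₂ _◂_ (xor-assoc β β' β'') (Bits-⊕-assoc xs ys zs) ⟩
  (β xor (β' xor β'')) ◂ (q ⊕ (q' ⊕ q''))  ≡⟨ ⊕-◂ β (β' xor β'') q (q' ⊕ q'') ⟨
  (β ◂ q) ⊕ ((β' xor β'') ◂ (q' ⊕ q''))    ≡⟨ cong ((β ◂ q) ⊕_) (⊕-◂ β' β'' q' q'') ⟨
  (β ◂ q) ⊕ ((β' ◂ q') ⊕ (β'' ◂ q''))      ∎
  where open ≡-Reasoning

⊕-identityˡ : ∀ x → 0 ⊕ x ≡ x
⊕-identityˡ x = Bits-⊕-identityˡ (≤⇒Bits (≤-refl {x}))

⊕-same : ∀ x → x ⊕ x ≡ 0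
⊕-same x = Bits-⊕-same (≤⇒Bits (≤-refl {x}))

⊕-comm : ∀ x y → x ⊕ y ≡ y ⊕ x
⊕-comm x y = Bits-⊕-comm (≤⇒Bits (m≤m+n x y)) (≤⇒Bits (m≤n+m y x))

⊕-assoc : ∀ x y z → (x ⊕ y) ⊕ z ≡ x ⊕ (y ⊕ z)
⊕-assoc x y z = Bits-⊕-assoc (≤⇒Bits (≤-trans (m≤m+n x y) (m≤m+n (x + y) z)))
                             (≤⇒Bits (≤-trans (m≤n+m y x) (m≤m+n (x + y) z)))
                             (≤⇒Bits (m≤n+m z (x + y)))

⊕-identityʳ : ∀ x → x ⊕ 0 ≡ x
⊕-identityʳ x = trans (⊕-comm x 0) (⊕-identityˡ x)

⊕-cancelˡ : ∀ x y → x ⊕ (x ⊕ y) ≡ y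
⊕-cancelˡ x y = trans (sym (⊕-assoc x x y)) (trans (cong (_⊕ y) (⊕-same x)) (⊕-identityˡ y))

x⊕[y⊕z]≡y⊕[x⊕z] : ∀ x y z → x ⊕ (y ⊕ z) ≡ y ⊕ (x ⊕ z)
x⊕[y⊕z]≡y⊕[x⊕z] x y z = trans (sym (⊕-assoc x y z)) (trans (cong (_⊕ z) (⊕-comm x y)) (⊕-assoc y x z))

⊕≡0⇒≡ : ∀ x y → x ⊕ y ≡ 0 → x ≡ y
⊕≡0⇒≡ x y x⊕y≡0 = begin
  x            ≡⟨ ⊕-identityʳ x ⟨
  x ⊕ 0        ≡⟨ cong (x ⊕_) (⊕-same y) ⟨
  x ⊕ (y ⊕ y)  ≡⟨ ⊕-assoc x y y ⟨
  (x ⊕ y) ⊕ y  ≡⟨ cong (_⊕ y) x⊕y≡0 ⟩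
  0 ⊕ y        ≡⟨ ⊕-identityˡ y ⟩
  y            ∎
  where open ≡-Reasoning

⊕-high-low : ∀ {b l l'} i j → Bits b l → Bits b l' →
             (2 ^ b * i + l) ⊕ (2 ^ b * j + l') ≡ 2 ^ b * (i ⊕ j) + (l ⊕ l')
⊕-high-low i j [] [] = begin
  (1 * i + 0) ⊕ (1 * j + 0)  ≡⟨ cong₂ _⊕_ (1*n+0≡n i) (1*n+0≡n j) ⟩
  i ⊕ j                      ≡⟨ 1*n+0≡n (i ⊕ j) ⟨
  1 * (i ⊕ j) + 0            ∎
  where
  open ≡-Reasoning
  1*n+0≡n : ∀ n → 1 * n + 0 ≡ n
  1*n+0≡n n = trans (+-identityʳ (1 * n)) (*-identityˡ n)
⊕-high-low {suc b} i j (_∷_ {q = q} β ls) (_∷_ {q = q'} β' ls') = begin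
  (2 ^ suc b * i + β ◂ q) ⊕ (2 ^ suc b * j + β' ◂ q')  ≡⟨ cong₂ _⊕_ (shift i β q) (shift j β' q') ⟩
  (β ◂ (2 ^ b * i + q)) ⊕ (β' ◂ (2 ^ b * j + q'))      ≡⟨ ⊕-◂ β β' _ _ ⟩
  (β xor β') ◂ ((2 ^ b * i + q) ⊕ (2 ^ b * j + q'))    ≡⟨ cong ((β xor β') ◂_) (⊕-high-low i j ls ls') ⟩
  (β xor β') ◂ (2 ^ b * (i ⊕ j) + (q ⊕ q'))            ≡⟨ shift (i ⊕ j) (β xor β') (q ⊕ q') ⟨
  2 ^ suc b * (i ⊕ j) + (β xor β') ◂ (q ⊕ q')          ≡⟨ cong (_+_ (2 ^ suc b * (i ⊕ j))) (⊕-◂ β β' q q') ⟨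
  2 ^ suc b * (i ⊕ j) + ((β ◂ q) ⊕ (β' ◂ q'))          ∎
  where
  open ≡-Reasoning
  shift : ∀ i β q → 2 ^ suc b * i + β ◂ q ≡ β ◂ (2 ^ b * i + q)
  shift i β q rewrite double≡*2 q | double≡*2 (2 ^ b * i + q) = ring (2 ^ b) i (bit β) q
    where
    ring : ∀ P i β q → 2 * P * i + (β + q * 2) ≡ β + (P * i + q) * 2
    ring = solve-∀

bit-⊕ : ∀ h h' → bit h ⊕ bit h' ≡ bit (h xor h')
bit-⊕ false false = refl
bit-⊕ false true  = refl
bit-⊕ true  false = refl
bit-⊕ true  true  = refl

⊕-top-bit : ∀ b g h {x l} → x < 2 ^ b → l < 2 ^ b →
            (2 ^ b * bit g + x) ⊕ (2 ^ b * bit h + l) ≡ 2 ^ b * bit (g xor h) + (x ⊕ l)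
⊕-top-bit b g h x<2^b l<2^b =
  trans (⊕-high-low (bit g) (bit h) (<⇒Bits b x<2^b) (<⇒Bits b l<2^b))
        (cong (λ i → 2 ^ b * i + _) (bit-⊕ g h))

-- Finite sums

∑ : ℕ → (ℕ → ℕ) → ℕ
∑ zero    f = 0
∑ (suc n) f = f 0 + ∑ n (λ x → f (suc x))

∑-cong : ∀ n {f g} → (∀ x → x < n → f x ≡ g x) → ∑ n f ≡ ∑ n g
∑-cong zero    f≗g = refl
∑-cong (suc n) f≗g = cong₂ _+_ (f≗g 0 (s≤s z≤n)) (∑-cong n (λ x x<n → f≗g (suc x) (s≤s x<n)))

∑-const : ∀ n c → ∑ n (λ _ → c) ≡ n * c
∑-const zero    c = refl
∑-const (suc n) c = cong (_+_ c) (∑-const n c)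

∑-zero : ∀ n {f} → (∀ x → f x ≡ 0) → ∑ n f ≡ 0
∑-zero n {f} f≗0 = trans (∑-cong n (λ x _ → f≗0 x)) (trans (∑-const n 0) (*-zeroʳ n))

∑-distrib-+ : ∀ n f g → ∑ n (λ x → f x + g x) ≡ ∑ n f + ∑ n g
∑-distrib-+ zero    f g = refl
∑-distrib-+ (suc n) f g =
  trans (cong (_+_ (f 0 + g 0)) (∑-distrib-+ n _ _)) (+-+-comm (f 0) (g 0) _ _)
  where
  +-+-comm : ∀ a b c d → a + b + (c + d) ≡ a + c + (b + d)
  +-+-comm = solve-∀

∑-comm : ∀ m n (f : ℕ → ℕ → ℕ) → ∑ m (λ x → ∑ n (f x)) ≡ ∑ n (λ y → ∑ m (λ x → f x y))
∑-comm zero    n f = sym (∑-zero n (λ _ → refl))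
∑-comm (suc m) n f =
  trans (cong (_+_ (∑ n (f 0))) (∑-comm m n (λ x → f (suc x))))
        (sym (∑-distrib-+ n (f 0) (λ y → ∑ m (λ x → f (suc x) y))))

∑-+ : ∀ m n f → ∑ (m + n) f ≡ ∑ m f + ∑ n (λ y → f (m + y))
∑-+ zero    n f = refl
∑-+ (suc m) n f = trans (cong (_+_ (f 0)) (∑-+ m n (λ x → f (suc x)))) (sym (+-assoc (f 0) _ _))

∑-unique : ∀ n {l f} → l < n → f l ≡ 1 → (∀ x → x ≢ l → f x ≡ 0) → ∑ n f ≡ 1
∑-unique (suc n) {zero}  _         f0≡1 f≢ = cong₂ _+_ f0≡1 (∑-zero n (λ x → f≢ (suc x) (λ ())))
∑-unique (suc n) {suc l} (s≤s l<n) fl≡1 f≢ =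
  cong₂ _+_ (f≢ 0 (λ ())) (∑-unique n l<n fl≡1 (λ x x≢l → f≢ (suc x) (λ { refl → x≢l refl })))

sum-map-applyUpTo : ∀ (f : ℕ → ℕ) g n → sum (map f (applyUpTo g n)) ≡ ∑ n (λ x → f (g x))
sum-map-applyUpTo f g zero    = refl
sum-map-applyUpTo f g (suc n) = cong (_+_ (f (g 0))) (sum-map-applyUpTo f (λ x → g (suc x)) n)

-- Counting positions by their nim-sum

module _ {A B : Set} {P : Pred B 0ℓ} (P? : Decidable P) where

  length-filter-concatMap : ∀ (g : A → List B) xs →
    length (filter P? (concatMap g xs)) ≡ sum (map (λ x → length (filter P? (g x))) xs)
  length-filter-concatMap g []       = refl
  length-filter-concatMap g (x ∷ xs) = begin
    length (filter P? (g x List.++ concatMap g xs))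
      ≡⟨ cong length (filter-++ P? (g x) _) ⟩
    length (filter P? (g x) List.++ filter P? (concatMap g xs))
      ≡⟨ length-++ (filter P? (g x)) ⟩
    length (filter P? (g x)) + length (filter P? (concatMap g xs))
      ≡⟨ cong (_+_ (length (filter P? (g x)))) (length-filter-concatMap g xs) ⟩
    length (filter P? (g x)) + sum (map (λ x → length (filter P? (g x))) xs) ∎
    where open ≡-Reasoning

  length-filter-map : ∀ (f : A → B) xs → length (filter P? (map f xs)) ≡ length (filter (λ x → P? (f x)) xs)
  length-filter-map f []       = refl
  length-filter-map f (x ∷ xs) with does (P? (f x))
  ... | true  = cong suc (length-filter-map f xs)
  ... | false = length-filter-map f xs

δ₀ : ℕ → ℕ
δ₀ zero    = 1
δ₀ (suc _) = 0

δ₀-pos : ∀ {n} → 0 < n → δ₀ n ≡ 0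
δ₀-pos (s≤s _) = refl

nimCount : ℕ → ℕ → ℕ → ℕ
nimCount zero    m t = δ₀ t
nimCount (suc k) m t = ∑ (suc m) (λ x → nimCount k m (x ⊕ t))

count≡nimCount : ∀ k m t → length (filter (λ p → nimSum p ≟ t) (tuples k m)) ≡ nimCount k m t
count≡nimCount zero    m zero    = refl
count≡nimCount zero    m (suc t) = refl
count≡nimCount (suc k) m t = begin
  length (filter (λ p → nimSum p ≟ t) (tuples (suc k) m))
    ≡⟨ length-filter-concatMap (λ p → nimSum p ≟ t) (λ x → map (x Vec.∷_) (tuples k m)) (upTo (suc m)) ⟩
  sum (map (λ x → length (filter (λ p → nimSum p ≟ t) (map (x Vec.∷_) (tuples k m)))) (upTo (suc m)))
    ≡⟨ sum-map-applyUpTo _ (λ x → x) (suc m) ⟩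
  ∑ (suc m) (λ x → length (filter (λ p → nimSum p ≟ t) (map (x Vec.∷_) (tuples k m))))
    ≡⟨ ∑-cong (suc m) (λ x _ → first-pile x) ⟩
  ∑ (suc m) (λ x → nimCount k m (x ⊕ t)) ∎
  where
  open ≡-Reasoning
  first-pile : ∀ x → length (filter (λ p → nimSum p ≟ t) (map (x Vec.∷_) (tuples k m))) ≡ nimCount k m (x ⊕ t)
  first-pile x = begin
    length (filter (λ p → nimSum p ≟ t) (map (x Vec.∷_) (tuples k m)))
      ≡⟨ length-filter-map (λ p → nimSum p ≟ t) (x Vec.∷_) (tuples k m) ⟩
    length (filter (λ p → x ⊕ nimSum p ≟ t) (tuples k m))
      ≡⟨ cong length (filter-≐ _ _ (move , unmove) (tuples k m)) ⟩
    length (filter (λ p → nimSum p ≟ x ⊕ t) (tuples k m))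
      ≡⟨ count≡nimCount k m (x ⊕ t) ⟩
    nimCount k m (x ⊕ t) ∎
    where
    move : ∀ {s} → x ⊕ s ≡ t → s ≡ x ⊕ t
    move {s} refl = sym (⊕-cancelˡ x s)
    unmove : ∀ {s} → s ≡ x ⊕ t → x ⊕ s ≡ t
    unmove refl = ⊕-cancelˡ x t

a≡nimCount : ∀ k m → a k m ≡ nimCount k m 0
a≡nimCount k m = count≡nimCount k m 0

-- Splitting off the top bit

odd : ℕ → Bool
odd zero    = false
odd (suc k) = not (odd k)

odd-*2 : ∀ q → odd (q * 2) ≡ false
odd-*2 zero    = refl
odd-*2 (suc q) = trans (not-involutive (odd (q * 2))) (odd-*2 q)

sign : Bool → ℤ
sign false = 1ℤ
sign true  = -1ℤ

pos-^ : ∀ x k → + (x ^ k) ≡ (+ x) ℤ.^ k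
pos-^ x zero    = refl
pos-^ x (suc k) = trans (ℤₚ.pos-* x (x ^ k)) (cong (ℤ._*_ (+ x)) (pos-^ x k))

recurrence-numerator : ℕ → ℕ → ℕ → ℤ
recurrence-numerator k b c = (+ ((2 ^ b + c) ^ k) ℤ.+ (+ (2 ^ b) - + c) ℤ.^ k) - + (2 * c ^ k)

module _ (m : ℕ) where

  -- For M ≥ m + 1, highCount k h l is the number of k-tuples of piles in
  -- [M, M + m] with nim-sum M · bit h + l, and highTotal k h is its sum over l < M.
  highCount : ℕ → Bool → ℕ → ℕ
  highCount zero    false l = δ₀ l
  highCount zero    true  l = 0
  highCount (suc k) h     l = ∑ (suc m) (λ y → highCount k (not h) (y ⊕ l))

  highTotal : ℕ → Bool → ℕ
  highTotal zero    false = 1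
  highTotal zero    true  = 0
  highTotal (suc k) h     = suc m * highTotal k (not h)

  highCount-odd : ∀ k l → highCount k (odd k) l ≡ nimCount k m l
  highCount-odd zero    l = refl
  highCount-odd (suc k) l = ∑-cong (suc m) (λ y _ →
    trans (cong (λ h → highCount k h (y ⊕ l)) (not-involutive (odd k))) (highCount-odd k (y ⊕ l)))

  highTotal-odd : ∀ k → highTotal k (odd k) ≡ suc m ^ k
  highTotal-odd zero    = refl
  highTotal-odd (suc k) = cong (suc m *_) (trans (cong (highTotal k) (not-involutive (odd k))) (highTotal-odd k))

  module _ (b : ℕ) (m<2^b : m < 2 ^ b) where

    ∑-highCount : ∀ k h {l} → l < 2 ^ b → ∑ (2 ^ b) (λ x → highCount k h (x ⊕ l)) ≡ highTotal k h
    ∑-highCount zero false {l} l<2^b =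
      ∑-unique (2 ^ b) l<2^b (cong δ₀ (⊕-same l))
        (λ x x≢l → δ₀-pos (n≢0⇒n>0 (λ x⊕l≡0 → x≢l (⊕≡0⇒≡ x l x⊕l≡0))))
    ∑-highCount zero true  _ = ∑-zero (2 ^ b) (λ _ → refl)
    ∑-highCount (suc k) h {l} l<2^b = begin
      ∑ (2 ^ b) (λ x → ∑ (suc m) (λ y → highCount k (not h) (y ⊕ (x ⊕ l))))
        ≡⟨ ∑-comm (2 ^ b) (suc m) (λ x y → highCount k (not h) (y ⊕ (x ⊕ l))) ⟩
      ∑ (suc m) (λ y → ∑ (2 ^ b) (λ x → highCount k (not h) (y ⊕ (x ⊕ l))))
        ≡⟨ ∑-cong (suc m) (λ y y<1+m → trans
             (∑-cong (2 ^ b) (λ x _ → cong (highCount k (not h)) (x⊕[y⊕z]≡y⊕[x⊕z] y x l)))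
             (∑-highCount k (not h) (⊕-< b (<-≤-trans y<1+m m<2^b) l<2^b))) ⟩
      ∑ (suc m) (λ _ → highTotal k (not h))
        ≡⟨ ∑-const (suc m) _ ⟩
      suc m * highTotal k (not h) ∎
      where open ≡-Reasoning

    -- The number of k-tuples with a pile below 2^b, with entries at most 2^b + m
    -- and nim-sum 2^b · bit h + l: it does not depend on l < 2^b.
    mixedCount : ℕ → Bool → ℕ
    mixedCount zero    h = 0
    mixedCount (suc k) h = 2 ^ b * mixedCount k h + highTotal k h + suc m * mixedCount k (not h)

    nimCount-split : ∀ k h {l} → l < 2 ^ b →
                     nimCount k (2 ^ b + m) (2 ^ b * bit h + l) ≡ mixedCount k h + highCount k h l
    nimCount-split zero false {l} _ = cong δ₀ (cong (λ z → z + l) (*-zeroʳ (2 ^ b)))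
    nimCount-split zero true  {l} _ =
      δ₀-pos (<-≤-trans (m^n>0 2 b) (≤-trans (≤-reflexive (sym (*-identityʳ (2 ^ b)))) (m≤m+n _ l)))
    nimCount-split (suc k) h {l} l<2^b = begin
      ∑ (suc (2 ^ b + m)) (λ x → nimCount k n (x ⊕ t))
        ≡⟨ cong (λ r → ∑ r (λ x → nimCount k n (x ⊕ t))) (sym (+-suc (2 ^ b) m)) ⟩
      ∑ (2 ^ b + suc m) (λ x → nimCount k n (x ⊕ t))
        ≡⟨ ∑-+ (2 ^ b) (suc m) _ ⟩
      ∑ (2 ^ b) (λ x → nimCount k n (x ⊕ t)) + ∑ (suc m) (λ y → nimCount k n ((2 ^ b + y) ⊕ t))
        ≡⟨ cong₂ _+_ (∑-cong (2 ^ b) (λ x → first-pile false (cong (λ z → z + x) (*-zeroʳ (2 ^ b)))))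
                     (∑-cong (suc m) (λ y y<1+m → first-pile true (cong (λ z → z + y) (*-identityʳ (2 ^ b)))
                                                            (<-≤-trans y<1+m m<2^b))) ⟩
      ∑ (2 ^ b) (λ x → mixedCount k h + highCount k h (x ⊕ l))
        + ∑ (suc m) (λ y → mixedCount k (not h) + highCount k (not h) (y ⊕ l))
        ≡⟨ cong₂ _+_ (∑-distrib-+ (2 ^ b) (λ _ → mixedCount k h) (λ x → highCount k h (x ⊕ l)))
                     (∑-distrib-+ (suc m) (λ _ → mixedCount k (not h)) (λ y → highCount k (not h) (y ⊕ l))) ⟩
      (∑ (2 ^ b) (λ _ → mixedCount k h) + ∑ (2 ^ b) (λ x → highCount k h (x ⊕ l)))
        + (∑ (suc m) (λ _ → mixedCount k (not h)) + highCount (suc k) h l)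
        ≡⟨ cong₂ _+_ (cong₂ _+_ (∑-const (2 ^ b) (mixedCount k h)) (∑-highCount k h l<2^b))
                     (cong (λ z → z + highCount (suc k) h l) (∑-const (suc m) (mixedCount k (not h)))) ⟩
      (2 ^ b * mixedCount k h + highTotal k h) + (suc m * mixedCount k (not h) + highCount (suc k) h l)
        ≡⟨ +-assoc-4 (2 ^ b * mixedCount k h) (highTotal k h) _ _ ⟩
      mixedCount (suc k) h + highCount (suc k) h l ∎
      where
      open ≡-Reasoning
      n = 2 ^ b + m
      t = 2 ^ b * bit h + l
      first-pile : ∀ g {x y} → 2 ^ b * bit g + y ≡ x → y < 2 ^ b →
             nimCount k n (x ⊕ t) ≡ mixedCount k (g xor h) + highCount k (g xor h) (y ⊕ l)
      first-pile g refl y<2^b = trans (cong (nimCount k n) (⊕-top-bit b g h y<2^b l<2^b))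
                                (nimCount-split k (g xor h) (⊕-< b y<2^b l<2^b))
      +-assoc-4 : ∀ a b c d → a + b + (c + d) ≡ a + b + c + d
      +-assoc-4 = solve-∀

    -- N k h = 2^(b+1) · mixedCount k h + 2 · highTotal k h satisfies
    -- N (k+1) h = 2^b · N k h + (m+1) · N k (not h).
    mixedCount-closed : ∀ k h → + (2 * 2 ^ b * mixedCount k h + 2 * highTotal k h) ≡
                        (+ (2 ^ b) ℤ.+ + suc m) ℤ.^ k ℤ.+ sign h ℤ.* (+ (2 ^ b) - + suc m) ℤ.^ k
    mixedCount-closed zero false = cong (λ z → + (z + 2)) (*-zeroʳ (2 * 2 ^ b))
    mixedCount-closed zero true  = cong (λ z → + (z + 0)) (*-zeroʳ (2 * 2 ^ b))
    mixedCount-closed (suc k) h = begin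
      + (2 * M * (M * d + e + c * d') + 2 * (c * e'))
        ≡⟨ cong +_ (regroup M c d e d' e') ⟩
      + (M * (2 * M * d + 2 * e) + c * (2 * M * d' + 2 * e'))
        ≡⟨ trans (ℤₚ.pos-+ (M * _) (c * _)) (cong₂ ℤ._+_ (ℤₚ.pos-* M _) (ℤₚ.pos-* c _)) ⟩
      + M ℤ.* + (2 * M * d + 2 * e) ℤ.+ + c ℤ.* + (2 * M * d' + 2 * e')
        ≡⟨ cong₂ (λ u v → + M ℤ.* u ℤ.+ + c ℤ.* v) (mixedCount-closed k h) (mixedCount-closed k (not h)) ⟩
      + M ℤ.* (A ℤ.^ k ℤ.+ sign h ℤ.* B ℤ.^ k) ℤ.+ + c ℤ.* (A ℤ.^ k ℤ.+ sign (not h) ℤ.* B ℤ.^ k)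
        ≡⟨ cong (λ s → + M ℤ.* (A ℤ.^ k ℤ.+ sign h ℤ.* B ℤ.^ k) ℤ.+ + c ℤ.* (A ℤ.^ k ℤ.+ s ℤ.* B ℤ.^ k))
                (sign-not h) ⟩
      + M ℤ.* (A ℤ.^ k ℤ.+ sign h ℤ.* B ℤ.^ k) ℤ.+ + c ℤ.* (A ℤ.^ k ℤ.+ ℤ.- sign h ℤ.* B ℤ.^ k)
        ≡⟨ binomial-step (+ M) (+ c) (sign h) (A ℤ.^ k) (B ℤ.^ k) ⟩
      A ℤ.^ suc k ℤ.+ sign h ℤ.* B ℤ.^ suc k ∎
      where
      open ≡-Reasoning
      M = 2 ^ b
      c = suc m
      d = mixedCount k h
      d' = mixedCount k (not h)
      e = highTotal k h
      e' = highTotal k (not h)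
      A = + M ℤ.+ + c
      B = + M - + c
      regroup : ∀ M c d e d' e' →
                2 * M * (M * d + e + c * d') + 2 * (c * e') ≡ M * (2 * M * d + 2 * e) + c * (2 * M * d' + 2 * e')
      regroup = solve-∀
      binomial-step : ∀ M c s X Y → M ℤ.* (X ℤ.+ s ℤ.* Y) ℤ.+ c ℤ.* (X ℤ.+ ℤ.- s ℤ.* Y) ≡
                      (M ℤ.+ c) ℤ.* X ℤ.+ s ℤ.* ((M - c) ℤ.* Y)
      binomial-step = ℤ-Solver.solve-∀
      sign-not : ∀ h → sign (not h) ≡ ℤ.- sign h
      sign-not false = refl
      sign-not true  = refl

    a-split : ∀ k → odd k ≡ false → a k (2 ^ b + m) ≡ mixedCount k false + a k m
    a-split k k-even = begin
      a k (2 ^ b + m)                                 ≡⟨ a≡nimCount k (2 ^ b + m) ⟩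
      nimCount k (2 ^ b + m) 0                        ≡⟨ cong (nimCount k (2 ^ b + m)) 2^b*0+0≡0 ⟨
      nimCount k (2 ^ b + m) (2 ^ b * bit false + 0)  ≡⟨ nimCount-split k false (m^n>0 2 b) ⟩
      mixedCount k false + highCount k false 0        ≡⟨ cong (λ h → mixedCount k false + highCount k h 0) k-even ⟨
      mixedCount k false + highCount k (odd k) 0      ≡⟨ cong (_+_ (mixedCount k false)) (highCount-odd k 0) ⟩
      mixedCount k false + nimCount k m 0             ≡⟨ cong (_+_ (mixedCount k false)) (a≡nimCount k m) ⟨
      mixedCount k false + a k m                      ∎
      where
      open ≡-Reasoning
      2^b*0+0≡0 : 2 ^ b * 0 + 0 ≡ 0
      2^b*0+0≡0 = trans (+-identityʳ (2 ^ b * 0)) (*-zeroʳ (2 ^ b))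

    a-recurrence : ∀ k → odd k ≡ false →
                   + (2 ^ (b + 1)) ℤ.* (+ a k (2 ^ b + m) - + a k m) ≡ recurrence-numerator k b (suc m)
    a-recurrence k k-even = begin
      + (2 ^ (b + 1)) ℤ.* (+ a k (2 ^ b + m) - + a k m)
        ≡⟨ cong₂ (λ p q → + p ℤ.* (+ q - + a k m)) (cong (2 ^_) (+-comm b 1)) (a-split k k-even) ⟩
      + (2 * 2 ^ b) ℤ.* (+ (d + a k m) - + a k m)
        ≡⟨ cong (ℤ._*_ (+ (2 * 2 ^ b)))
                (trans (cong (λ z → z - + a k m) (ℤₚ.pos-+ d (a k m))) (add-sub (+ d) (+ a k m))) ⟩
      + (2 * 2 ^ b) ℤ.* + d
        ≡⟨ ℤₚ.pos-* (2 * 2 ^ b) d ⟨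
      + (2 * 2 ^ b * d)
        ≡⟨ add-sub (+ (2 * 2 ^ b * d)) (+ (2 * e)) ⟨
      (+ (2 * 2 ^ b * d) ℤ.+ + (2 * e)) - + (2 * e)
        ≡⟨ cong (λ z → z - + (2 * e)) (ℤₚ.pos-+ (2 * 2 ^ b * d) (2 * e)) ⟨
      + (2 * 2 ^ b * d + 2 * e) - + (2 * e)
        ≡⟨ cong₂ _-_ (mixedCount-closed k false) (cong (λ z → + (2 * z)) e≡c^k) ⟩
      ((+ (2 ^ b) ℤ.+ + c) ℤ.^ k ℤ.+ 1ℤ ℤ.* (+ (2 ^ b) - + c) ℤ.^ k) - + (2 * c ^ k)
        ≡⟨ cong₂ (λ u v → (u ℤ.+ v) - + (2 * c ^ k))
                 (sym (trans (pos-^ (2 ^ b + c) k) (cong (ℤ._^ k) (ℤₚ.pos-+ (2 ^ b) c))))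
                 (ℤₚ.*-identityˡ _) ⟩
      recurrence-numerator k b c ∎
      where
      open ≡-Reasoning
      c = suc m
      d = mixedCount k false
      e = highTotal k false
      add-sub : ∀ x y → (x ℤ.+ y) - y ≡ x
      add-sub = ℤ-Solver.solve-∀
      e≡c^k : e ≡ c ^ k
      e≡c^k = subst (λ h → highTotal k h ≡ c ^ k) k-even (highTotal-odd k)

theorem17 : (k : ℕ) → 1 ≤ k → 2 ∣ k → (n : ℕ) → 1 ≤ n →
    let b = ⌊log₂ n ⌋
        c = n + 1 ∸ 2 ^ b
        N = (+ ((2 ^ b + c) ^ k) Data.Integer.+ (+ (2 ^ b) - + c) Data.Integer.^ k) - + (2 * c ^ k)
    in (+ (2 ^ (b + 1))) Data.Integer.* (+ a k n - + a k (c ∸ 1)) ≡ N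
theorem17 k _ (divides q k≡q*2) n 1≤n =
  subst₂ (λ n′ c → + (2 ^ (b + 1)) ℤ.* (+ a k n′ - + a k (c ∸ 1)) ≡ recurrence-numerator k b c)
         (m+[n∸m]≡n 2^b≤n) 1+m≡c
         (a-recurrence m b m<2^b k (subst (λ k → odd k ≡ false) (sym k≡q*2) (odd-*2 q)))
  where
  b = ⌊log₂ n ⌋
  m = n ∸ 2 ^ b
  2^b≤n : 2 ^ b ≤ n
  2^b≤n = proj₁ (log₂-bounds n 1≤n)
  n<2^b+2^b : n < 2 ^ b + 2 ^ b
  n<2^b+2^b = subst (n <_) (cong (_+_ (2 ^ b)) (+-identityʳ (2 ^ b))) (proj₂ (log₂-bounds n 1≤n))
  m<2^b : m < 2 ^ b
  m<2^b = subst (m <_) (m+n∸m≡n (2 ^ b) (2 ^ b)) (∸-monoˡ-< n<2^b+2^b 2^b≤n)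
  1+m≡c : suc m ≡ n + 1 ∸ 2 ^ b
  1+m≡c = trans (+-comm 1 m) (sym (+-∸-comm 1 2^b≤n))
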